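{- For $n\ge 3$, the cycle $C_n$ satisfies $\nu_*(C_n)=6n-4$.
   Context: For a finite simple graph $G=(V,E)$ with $p=|V|$, $q=|E|$, $\ell=p+q$, a construction sequence (c-sequence) for $G$ is a bijection $x:\{1,\dots,\ell\}\to V\sqcup E$ such that for every edge $e=uw$, $x^{ -1}(e)>\max\{x^{ -1}(u),x^{ -1}(w)\}$. The cost of an edge $e=uw$ in $x$ is $\nu(e,x)=(x^{ -1}(e)-x^{ -1}(u))+(x^{ -1}(e)-x^{ -1}(w))$, and the cost of $x$ is $\nu(x)=\sum_{e\in E}\nu(e,x)$. The min cost of $G$ is $\nu_*(G)=\min\nu(x)$ over all c-sequences $x$ for $G$. -}

module Defs where

open import Data.Nat using (ℕ; zero; suc; _+_; _∸_; _<_; _≤_)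
open import Data.Nat.DivMod using (_mod_)
open import Data.Fin using (Fin; toℕ)
open import Data.Sum using (_⊎_; inj₁; inj₂)
open import Data.Product using (_×_; _,_; proj₁; proj₂; ∃)
open import Data.List using (tabulate)
open import Data.Nat.ListAction using (sum)
open import Function.Bundles using (_↔_; Inverse)
open import Relation.Binary.PropositionalEquality using (_≡_; _≢_)

record Graph : Set where
  field
    p    : ℕ
    q    : ℕ
    ends : Fin q → Fin p × Fin p

open Graph public

IsSimple : Graph → Set
IsSimple G =
  (∀ e → proj₁ (ends G e) ≢ proj₂ (ends G e)) ×
  (∀ e f → ((proj₁ (ends G e) ≡ proj₁ (ends G f) × proj₂ (ends G e) ≡ proj₂ (ends G f))
            ⊎ (proj₁ (ends G e) ≡ proj₂ (ends G f) × proj₂ (ends G e) ≡ proj₁ (ends G f)))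
         → e ≡ f)

Elem : Graph → Set
Elem G = Fin (p G) ⊎ Fin (q G)

-- A sequence: bijection between positions {0,…,ℓ-1} (shift of {1,…,ℓ}) and V ⊔ E.
Seq : Graph → Set
Seq G = Fin (p G + q G) ↔ Elem G

pos : {G : Graph} → Seq G → Elem G → ℕ
pos x a = toℕ (Inverse.from x a)

IsCSeq : (G : Graph) → Seq G → Set
IsCSeq G x = ∀ e →
  (pos {G} x (inj₁ (proj₁ (ends G e))) < pos {G} x (inj₂ e)) ×
  (pos {G} x (inj₁ (proj₂ (ends G e))) < pos {G} x (inj₂ e))

edgeCost : (G : Graph) → Seq G → Fin (q G) → ℕ
edgeCost G x e =
  (pos {G} x (inj₂ e) ∸ pos {G} x (inj₁ (proj₁ (ends G e)))) +
  (pos {G} x (inj₂ e) ∸ pos {G} x (inj₁ (proj₂ (ends G e))))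

cost : (G : Graph) → Seq G → ℕ
cost G x = sum (tabulate (edgeCost G x))

IsMinCost : Graph → ℕ → Set
IsMinCost G m =
  (∃ λ (x : Seq G) → IsCSeq G x × cost G x ≡ m) ×
  (∀ (x : Seq G) → IsCSeq G x → m ≤ cost G x)

next : {n : ℕ} → Fin n → Fin n
next {suc k} i = suc (toℕ i) mod suc k

cycle : ℕ → Graph
cycle n = record { p = n ; q = n ; ends = λ i → (i , next i) }

module Submission where

-- Number the positions of a c-sequence of Cₙ from 0 and let Pv, Pe be the position sums of the
-- vertices and of the edges.  Every vertex lies on exactly two edges, so the cost is 2Pe − 2Pv,
-- while Pv + Pe = 0 + 1 + ⋯ + (2n − 1).  When the (b+1)-st edge is placed, the b+1 edges placed
-- so far span at least b+1 vertices of Cₙ, and at least b+2 unless b+1 = n; all of them precede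
-- that edge, so it stands in position ≥ 2b+2 (≥ 2n−1 for the last edge).  Hence Pe ≥ n² + n − 1,
-- i.e. the cost is at least 6n − 4, and the sequence v₀ v₁ e₀ v₂ e₁ ⋯ vₙ₋₁ eₙ₋₂ eₙ₋₁ attains it.

open import Defs
open import Data.Nat using (ℕ; zero; suc; _+_; _*_; _∸_; _<_; _≤_; z≤n; s≤s; s≤s⁻¹)
open import Data.Nat.Properties
open import Data.Nat.Tactic.RingSolver using (solve-∀; solve)
import Data.Nat.ListAction as List
open import Data.Nat.DivMod using (_%_; m<n⇒m%n≡m; n%n≡0)
open import Data.Fin using (Fin; zero; suc; toℕ; fromℕ; fromℕ<; inject₁; splitAt; join; _↑ˡ_; _↑ʳ_)
open import Data.Fin.Properties
  using (toℕ-injective; toℕ<n; toℕ-fromℕ<; toℕ-fromℕ; toℕ-inject₁; inject₁ℕ<; ≤fromℕ;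
         splitAt-↑ˡ; splitAt-↑ʳ; splitAt-join; +↔⊎)
open import Data.Fin.Induction using (<-weakInduction; <-weakInduction-startingFrom)
open import Data.Empty using (⊥-elim)
open import Data.Sum using (_⊎_; inj₁; inj₂)
import Data.Sum as Sum
open import Data.Product using (_×_; _,_; proj₁; proj₂)
open import Data.List using (tabulate; _∷_; [])
open import Function using (_∘_; _↔_; Inverse; mk↔ₛ′)
open import Function.Construct.Composition using (_↔-∘_)
open import Function.Construct.Symmetry using (↔-sym)
open import Relation.Binary.PropositionalEquality
open import Algebra.Properties.CommutativeMonoid.Sum +-0-commutativeMonoid
  using (sum; sum-cong-≗; ∑-distrib-+; sum-permute; sum-init-last)

sum-tabulate : ∀ {n} (f : Fin n → ℕ) → List.sum (tabulate f) ≡ sum f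
sum-tabulate {zero}  f = refl
sum-tabulate {suc n} f = cong (f zero +_) (sum-tabulate (f ∘ suc))

sum-const : ∀ n c → sum {n} (λ _ → c) ≡ n * c
sum-const zero    c = refl
sum-const (suc n) c = cong (c +_) (sum-const n c)

sum-zero : ∀ n → sum {n} (λ _ → 0) ≡ 0
sum-zero n = trans (sum-const n 0) (*-zeroʳ n)

sum-mono-≤ : ∀ {n} {f g : Fin n → ℕ} → (∀ i → f i ≤ g i) → sum f ≤ sum g
sum-mono-≤ {zero}  f≤g = z≤n
sum-mono-≤ {suc n} f≤g = +-mono-≤ (f≤g zero) (sum-mono-≤ (f≤g ∘ suc))

+-mono-≤-≡⇒≡ : ∀ {a b c d} → a ≤ c → b ≤ d → a + b ≡ c + d → a ≡ c × b ≡ d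
+-mono-≤-≡⇒≡ {a} {b} {c} {d} a≤c b≤d eq with m≤n⇒m<n∨m≡n a≤c
... | inj₁ a<c = ⊥-elim (<⇒≢ (+-mono-<-≤ a<c b≤d) eq)
... | inj₂ refl = refl , +-cancelˡ-≡ a b d eq

sum-mono-≤-≡⇒≗ : ∀ {n} {f g : Fin n → ℕ} → (∀ i → f i ≤ g i) → sum f ≡ sum g → ∀ i → f i ≡ g i
sum-mono-≤-≡⇒≗ {suc n} f≤g eq i with +-mono-≤-≡⇒≡ (f≤g zero) (sum-mono-≤ (f≤g ∘ suc)) eq
sum-mono-≤-≡⇒≗ {suc n} f≤g eq zero    | f₀≡g₀ , _ = f₀≡g₀
sum-mono-≤-≡⇒≗ {suc n} f≤g eq (suc i) | _ , rest = sum-mono-≤-≡⇒≗ (f≤g ∘ suc) rest i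

sum-≤1 : ∀ {n} (f : Fin n → ℕ) → (∀ i → f i ≤ 1) → sum f ≤ n
sum-≤1 {n} f f≤1 = subst (sum f ≤_) (trans (sum-const n 1) (*-identityʳ n)) (sum-mono-≤ f≤1)

≥1-everywhere⇒sum≡ : ∀ {n} (f : Fin n → ℕ) → (∀ i → f i ≤ 1) → (∀ i → 1 ≤ f i) → sum f ≡ n
≥1-everywhere⇒sum≡ {n} f f≤1 f≥1 =
  trans (sum-cong-≗ (λ i → ≤-antisym (f≤1 i) (f≥1 i))) (trans (sum-const n 1) (*-identityʳ n))

sum-splitAt : ∀ m {n} (h : Fin (m + n) → ℕ) → sum h ≡ sum (h ∘ (_↑ˡ n)) + sum (h ∘ (m ↑ʳ_))
sum-splitAt zero    h = refl
sum-splitAt (suc m) h = trans (cong (h zero +_) (sum-splitAt m (h ∘ suc))) (sym (+-assoc (h zero) _ _))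

sum-reindex : ∀ {m p q} (x : Fin m ↔ (Fin p ⊎ Fin q)) (g : Fin p ⊎ Fin q → ℕ) →
  sum (g ∘ inj₁) + sum (g ∘ inj₂) ≡ sum (g ∘ Inverse.to x)
sum-reindex {p = p} {q} x g = begin
  sum (g ∘ inj₁) + sum (g ∘ inj₂)        ≡⟨ cong₂ _+_ (sum-cong-≗ (λ i → cong g (sym (splitAt-↑ˡ p i q))))
                                                      (sum-cong-≗ (λ i → cong g (sym (splitAt-↑ʳ p q i)))) ⟩
  sum (h ∘ (_↑ˡ q)) + sum (h ∘ (p ↑ʳ_))  ≡⟨ sum-splitAt p h ⟨
  sum h                                  ≡⟨ sum-permute h (↔-sym +↔⊎ ↔-∘ x) ⟩
  sum (h ∘ join p q ∘ Inverse.to x)      ≡⟨ sum-cong-≗ (cong g ∘ splitAt-join p q ∘ Inverse.to x) ⟩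
  sum (g ∘ Inverse.to x)                 ∎
  where
  open ≡-Reasoning
  h : Fin (p + q) → ℕ
  h = g ∘ splitAt p

sum< : ℕ → (ℕ → ℕ) → ℕ
sum< zero    f = 0
sum< (suc m) f = f 0 + sum< m (f ∘ suc)

sum<-snoc : ∀ m f → sum< (suc m) f ≡ sum< m f + f m
sum<-snoc zero    f = +-comm (f 0) 0
sum<-snoc (suc m) f = trans (cong (f 0 +_) (sum<-snoc m (f ∘ suc))) (sym (+-assoc (f 0) _ _))

sum<-cong : ∀ m {f g} → (∀ j → j < m → f j ≡ g j) → sum< m f ≡ sum< m g
sum<-cong zero    f≡g = refl
sum<-cong (suc m) f≡g = cong₂ _+_ (f≡g 0 (s≤s z≤n)) (sum<-cong m (λ j j<m → f≡g (suc j) (s≤s j<m)))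

sum<-+ : ∀ m f g → sum< m (λ j → f j + g j) ≡ sum< m f + sum< m g
sum<-+ zero    f g = refl
sum<-+ (suc m) f g = trans (cong (f 0 + g 0 +_) (sum<-+ m (f ∘ suc) (g ∘ suc))) (interchange (f 0) (g 0) _ _)
  where
  interchange : ∀ a b c d → (a + b) + (c + d) ≡ (a + c) + (b + d)
  interchange = solve-∀

sum<-1 : ∀ m → sum< m (λ _ → 1) ≡ m
sum<-1 zero    = refl
sum<-1 (suc m) = cong suc (sum<-1 m)

sum<-++ : ∀ m d f → sum< (m + d) f ≡ sum< m f + sum< d (λ j → f (m + j))
sum<-++ zero    d f = refl
sum<-++ (suc m) d f = trans (cong (f 0 +_) (sum<-++ m d (f ∘ suc))) (sym (+-assoc (f 0) _ _))

sum<-zero : ∀ m {f} → (∀ j → j < m → f j ≡ 0) → sum< m f ≡ 0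
sum<-zero zero    f≡0 = refl
sum<-zero (suc m) f≡0 = cong₂ _+_ (f≡0 0 (s≤s z≤n)) (sum<-zero m (λ j j<m → f≡0 (suc j) (s≤s j<m)))

sum<-id : ∀ m → 2 * sum< m (λ j → j) + m ≡ m * m
sum<-id zero    = refl
sum<-id (suc m) = begin
  2 * sum< (suc m) (λ j → j) + suc m        ≡⟨ cong (λ s → 2 * s + suc m) (sum<-snoc m (λ j → j)) ⟩
  2 * (sum< m (λ j → j) + m) + suc m        ≡⟨ regroup (sum< m (λ j → j)) m ⟩
  (2 * sum< m (λ j → j) + m) + (1 + 2 * m)  ≡⟨ cong (_+ (1 + 2 * m)) (sum<-id m) ⟩
  m * m + (1 + 2 * m)                       ≡⟨ square-suc m ⟩
  suc m * suc m                             ∎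
  where
  open ≡-Reasoning
  regroup : ∀ s m → 2 * (s + m) + suc m ≡ (2 * s + m) + (1 + 2 * m)
  regroup = solve-∀
  square-suc : ∀ m → m * m + (1 + 2 * m) ≡ suc m * suc m
  square-suc = solve-∀

sum-toℕ : ∀ {n} (f : Fin n → ℕ) (g : ℕ → ℕ) → (∀ i → f i ≡ g (toℕ i)) → sum f ≡ sum< n g
sum-toℕ {zero}  f g f≡g = refl
sum-toℕ {suc n} f g f≡g = cong₂ _+_ (f≡g zero) (sum-toℕ (f ∘ suc) (g ∘ suc) (f≡g ∘ suc))

clamp : ∀ {m} → ℕ → Fin (suc m)
clamp {zero}  _       = zero
clamp {suc m} zero    = zero
clamp {suc m} (suc j) = suc (clamp j)

toℕ-clamp : ∀ {m j} → j ≤ m → toℕ (clamp {m} j) ≡ j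
toℕ-clamp {zero}  {zero}  _         = refl
toℕ-clamp {suc m} {zero}  _         = refl
toℕ-clamp {suc m} {suc j} (s≤s j≤m) = cong suc (toℕ-clamp j≤m)

clamp-toℕ : ∀ {m} (i : Fin (suc m)) → clamp (toℕ i) ≡ i
clamp-toℕ {zero}  zero    = refl
clamp-toℕ {suc m} zero    = refl
clamp-toℕ {suc m} (suc i) = cong suc (clamp-toℕ i)

infix 4 ⟦_<_⟧

⟦_<_⟧ : ℕ → ℕ → ℕ
⟦ j     < zero  ⟧ = 0
⟦ zero  < suc u ⟧ = 1
⟦ suc j < suc u ⟧ = ⟦ j < u ⟧

⟦<⟧≡1 : ∀ {j u} → j < u → ⟦ j < u ⟧ ≡ 1
⟦<⟧≡1 {zero}  {suc u} j<u       = refl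
⟦<⟧≡1 {suc j} {suc u} (s≤s j<u) = ⟦<⟧≡1 j<u

⟦≮⟧≡0 : ∀ {j u} → u ≤ j → ⟦ j < u ⟧ ≡ 0
⟦≮⟧≡0 {j}     {zero}  u≤j       = refl
⟦≮⟧≡0 {suc j} {suc u} (s≤s u≤j) = ⟦≮⟧≡0 u≤j

⟦<⟧≤1 : ∀ j u → ⟦ j < u ⟧ ≤ 1
⟦<⟧≤1 j       zero    = z≤n
⟦<⟧≤1 zero    (suc u) = s≤s z≤n
⟦<⟧≤1 (suc j) (suc u) = ⟦<⟧≤1 j u

⟦<⟧-positive : ∀ {j u} → 1 ≤ ⟦ j < u ⟧ → j < u
⟦<⟧-positive {zero}  {suc u} _   = s≤s z≤n
⟦<⟧-positive {suc j} {suc u} pos = s≤s (⟦<⟧-positive pos)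

sum<-⟦<⟧ : ∀ f {u m} → u ≤ m → sum< m (λ j → f j * ⟦ j < u ⟧) ≡ sum< u f
sum<-⟦<⟧ f {u} {m} u≤m = begin
  sum< m f<u                                     ≡⟨ cong (λ m → sum< m f<u) (m+[n∸m]≡n u≤m) ⟨
  sum< (u + (m ∸ u)) f<u                         ≡⟨ sum<-++ u (m ∸ u) f<u ⟩
  sum< u f<u + sum< (m ∸ u) (λ j → f<u (u + j))  ≡⟨ cong₂ _+_ (sum<-cong u below) (sum<-zero (m ∸ u) above) ⟩
  sum< u f + 0                                   ≡⟨ +-identityʳ _ ⟩
  sum< u f                                       ∎
  where
  open ≡-Reasoning
  f<u : ℕ → ℕ
  f<u j = f j * ⟦ j < u ⟧
  below : ∀ j → j < u → f<u j ≡ f j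
  below j j<u = trans (cong (f j *_) (⟦<⟧≡1 j<u)) (*-identityʳ (f j))
  above : ∀ j → j < m ∸ u → f<u (u + j) ≡ 0
  above j _ = trans (cong (f (u + j) *_) (⟦≮⟧≡0 (m≤m+n u j))) (*-zeroʳ (f (u + j)))

toℕ-next-< : ∀ {k} (i : Fin (suc k)) → toℕ i < k → toℕ (next i) ≡ suc (toℕ i)
toℕ-next-< i i<k = trans (toℕ-fromℕ< _) (m<n⇒m%n≡m (s≤s i<k))

toℕ-next-last : ∀ {k} (i : Fin (suc k)) → toℕ i ≡ k → toℕ (next i) ≡ 0
toℕ-next-last {k} i i≡k = trans (toℕ-fromℕ< _) (trans (cong (λ j → suc j % suc k) i≡k) (n%n≡0 (suc k)))

toℕ-next : ∀ {k} (i : Fin (suc k)) →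
  (toℕ i < k × toℕ (next i) ≡ suc (toℕ i)) ⊎ (toℕ i ≡ k × toℕ (next i) ≡ 0)
toℕ-next i with m≤n⇒m<n∨m≡n (s≤s⁻¹ (toℕ<n i))
... | inj₁ i<k = inj₁ (i<k , toℕ-next-< i i<k)
... | inj₂ i≡k = inj₂ (i≡k , toℕ-next-last i i≡k)

next-inject₁ : ∀ {k} (i : Fin k) → next (inject₁ i) ≡ suc i
next-inject₁ i = toℕ-injective (trans (toℕ-next-< (inject₁ i) (inject₁ℕ< i)) (cong suc (toℕ-inject₁ i)))

next-fromℕ : ∀ k → next (fromℕ k) ≡ zero
next-fromℕ k = toℕ-injective (toℕ-next-last (fromℕ k) (toℕ-fromℕ k))

next-closed⇒universal : ∀ {k} (P : Fin (suc k) → Set) → (∀ i → P i → P (next i)) →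
  ∀ {e} → P e → ∀ i → P i
next-closed⇒universal {k} P P-next {e} Pe = <-weakInduction P P₀ P-suc
  where
  P-suc : ∀ i → P (inject₁ i) → P (suc i)
  P-suc i = subst P (next-inject₁ i) ∘ P-next (inject₁ i)
  P₀ : P zero
  P₀ = subst P (next-fromℕ k) (P-next _ (<-weakInduction-startingFrom P Pe P-suc (≤fromℕ e)))

sum-next : ∀ {k} (f : Fin (suc k) → ℕ) → sum (f ∘ next) ≡ sum f
sum-next {k} f = begin
  sum (f ∘ next)                                 ≡⟨ sum-init-last (f ∘ next) ⟩
  sum (f ∘ next ∘ inject₁) + f (next (fromℕ k))  ≡⟨ cong₂ _+_ (sum-cong-≗ (cong f ∘ next-inject₁))
                                                              (cong f (next-fromℕ k)) ⟩
  sum (f ∘ suc) + f zero                         ≡⟨ +-comm _ (f zero) ⟩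
  sum f                                          ∎
  where open ≡-Reasoning

-- Sending edge i to its endpoint i injects the edges into S;
-- if that injection is onto, S is closed under next, hence spans the whole cycle.
module CycleSubgraph {k} (F S : Fin (suc k) → ℕ) (F≤1 : ∀ i → F i ≤ 1) (S≤1 : ∀ i → S i ≤ 1)
                     (ends∈S : ∀ i → 1 ≤ F i → 1 ≤ S i × 1 ≤ S (next i)) where

  F≤S : ∀ i → F i ≤ S i
  F≤S i with F i | F≤1 i | ends∈S i
  ... | 0           | _      | _    = z≤n
  ... | 1           | _      | ends = proj₁ (ends ≤-refl)
  ... | suc (suc _) | s≤s () | _

  edges≤vertices : sum F ≤ sum S
  edges≤vertices = sum-mono-≤ F≤S

  edges≡vertices⇒spanning : ∀ {e} → 1 ≤ F e → sum F ≡ sum S → sum S ≡ suc k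
  edges≡vertices⇒spanning {e} Fe F≡S = ≥1-everywhere⇒sum≡ S S≤1
    (next-closed⇒universal (λ i → 1 ≤ S i) S-next (proj₁ (ends∈S e Fe)))
    where
    S-next : ∀ i → 1 ≤ S i → 1 ≤ S (next i)
    S-next i Si = proj₂ (ends∈S i (subst (1 ≤_) (sym (sum-mono-≤-≡⇒≗ F≤S F≡S i)) Si))

next-no-fixpoint : ∀ {k} (i : Fin (suc (suc k))) → i ≢ next i
next-no-fixpoint i i≡next with toℕ-next i
... | inj₁ (_ , next≡suc) = 1+n≢n (sym (trans (cong toℕ i≡next) next≡suc))
... | inj₂ (i≡last , next≡0) = 0≢1+n (trans (sym next≡0) (trans (sym (cong toℕ i≡next)) i≡last))

next²-no-fixpoint : ∀ {k} (i : Fin (3 + k)) → next (next i) ≢ i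
next²-no-fixpoint i eq with cong toℕ eq | toℕ-next i | toℕ-next (next i)
... | i₂≡i | inj₁ (_ , i₁≡) | inj₁ (_ , i₂≡) =
  <⇒≢ (m<n⇒m<1+n (n<1+n (toℕ i))) (trans (sym i₂≡i) (trans i₂≡ (cong suc i₁≡)))
... | i₂≡i | inj₁ (_ , i₁≡) | inj₂ (i₁≡last , i₂≡)
  with () ← trans (cong suc (sym (trans (sym i₂≡i) i₂≡))) (trans (sym i₁≡) i₁≡last)
... | i₂≡i | inj₂ (i≡last , i₁≡) | inj₁ (_ , i₂≡)
  with () ← trans (sym (trans i₂≡ (cong suc i₁≡))) (trans i₂≡i i≡last)
... | _    | inj₂ (_ , i₁≡) | inj₂ (i₁≡last , _) with () ← trans (sym i₁≡) i₁≡last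

cycle-simple : ∀ m → IsSimple (cycle (3 + m))
cycle-simple m = next-no-fixpoint , no-parallel
  where
  no-parallel : ∀ e f → (e ≡ f × next e ≡ next f) ⊎ (e ≡ next f × next e ≡ f) → e ≡ f
  no-parallel e f (inj₁ (e≡f , _))             = e≡f
  no-parallel e f (inj₂ (e≡next-f , next-e≡f)) =
    ⊥-elim (next²-no-fixpoint f (trans (cong next (sym e≡next-f)) next-e≡f))

∸-cost : ∀ {a b c} → b < a → c < a → (a ∸ b) + (a ∸ c) + b + c ≡ a + a
∸-cost {a} {b} {c} b<a c<a = begin
  (a ∸ b) + (a ∸ c) + b + c      ≡⟨ regroup (a ∸ b) (a ∸ c) b c ⟩
  ((a ∸ b) + b) + ((a ∸ c) + c)  ≡⟨ cong₂ _+_ (m∸n+n≡m (<⇒≤ b<a)) (m∸n+n≡m (<⇒≤ c<a)) ⟩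
  a + a                          ∎
  where
  open ≡-Reasoning
  regroup : ∀ x y b c → x + y + b + c ≡ (x + b) + (y + c)
  regroup = solve-∀

cost-lower-bound-arithmetic : ∀ n c pv pe → c + pv + pv ≡ pe + pe →
  2 * (pv + pe) + (n + n) ≡ (n + n) * (n + n) → n * suc n ≤ suc pe → 6 * n ∸ 4 ≤ c
cost-lower-bound-arithmetic n c pv pe cost≡ positions≡ pronic =
  m≤n+o⇒m∸n≤o (6 * n) 4 (+-cancelˡ-≤ (2 * (pv + pe)) _ _ (begin
    2 * (pv + pe) + 6 * n                 ≡⟨ solve (pv ∷ pe ∷ n ∷ []) ⟩
    (2 * (pv + pe) + (n + n)) + 4 * n     ≡⟨ cong (_+ 4 * n) positions≡ ⟩
    (n + n) * (n + n) + 4 * n             ≡⟨ solve (n ∷ []) ⟩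
    4 * (n * suc n)                       ≤⟨ *-monoʳ-≤ 4 pronic ⟩
    4 * suc pe                            ≡⟨ solve (pe ∷ []) ⟩
    4 + (pe + pe) + (pe + pe)             ≡⟨ cong (λ t → 4 + t + (pe + pe)) cost≡ ⟨
    4 + (c + pv + pv) + (pe + pe)         ≡⟨ solve (c ∷ pv ∷ pe ∷ []) ⟩
    2 * (pv + pe) + (4 + c)               ∎))
  where open ≤-Reasoning

isEdge isVertex : ∀ {p q} → Fin p ⊎ Fin q → ℕ
isEdge   (inj₁ _) = 0
isEdge   (inj₂ _) = 1
isVertex (inj₁ _) = 1
isVertex (inj₂ _) = 0

isEdge+isVertex : ∀ {p q} (a : Fin p ⊎ Fin q) → isEdge a + isVertex a ≡ 1
isEdge+isVertex (inj₁ _) = refl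
isEdge+isVertex (inj₂ _) = refl

double-suc-≤ : ∀ d b a → 2 + b ≤ d + a → 2 * suc b ≤ d + (b + a)
double-suc-≤ d b a 2+b≤d+a = begin
  2 * suc b          ≡⟨ solve (b ∷ []) ⟩
  (2 + b) + b        ≤⟨ +-monoˡ-≤ b 2+b≤d+a ⟩
  (d + a) + b        ≡⟨ solve (d ∷ a ∷ b ∷ []) ⟩
  d + (b + a)        ∎
  where open ≤-Reasoning

pronic-step : ∀ d b s u → b * suc b ≤ s → 2 * suc b ≤ d + u → suc b * suc (suc b) ≤ d + (s + u)
pronic-step d b s u b[b+1]≤s 2[b+1]≤d+u = begin
  suc b * suc (suc b)      ≡⟨ solve (b ∷ []) ⟩
  b * suc b + 2 * suc b    ≤⟨ +-mono-≤ b[b+1]≤s 2[b+1]≤d+u ⟩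
  s + (d + u)              ≡⟨ solve (s ∷ d ∷ u ∷ []) ⟩
  d + (s + u)              ∎
  where open ≤-Reasoning

module LowerBound {k : ℕ} (x : Seq (cycle (suc k))) (x-cseq : IsCSeq (cycle (suc k)) x) where

  n M : ℕ
  n = suc k
  M = n + n

  position : Fin n ⊎ Fin n → ℕ
  position = pos {cycle n} x

  pv pe : Fin n → ℕ
  pv v = position (inj₁ v)
  pe e = position (inj₂ e)

  Pv Pe : ℕ
  Pv = sum pv
  Pe = sum pe

  -- the element in position j (junk for j ≥ M)
  at : ℕ → Fin n ⊎ Fin n
  at j = Inverse.to x (clamp j)

  position-at : ∀ {j} → j < M → position (at j) ≡ j
  position-at j<M = trans (cong toℕ (Inverse.strictlyInverseʳ x _)) (toℕ-clamp (s≤s⁻¹ j<M))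

  sum-by-position : (φ : Fin n ⊎ Fin n → ℕ → ℕ) →
    sum (λ v → φ (inj₁ v) (pv v)) + sum (λ e → φ (inj₂ e) (pe e)) ≡ sum< M (λ j → φ (at j) j)
  sum-by-position φ = trans (sum-reindex x (λ a → φ a (position a)))
    (sum-toℕ _ (λ j → φ (at j) j) (λ s → cong₂ φ (cong (Inverse.to x) (sym (clamp-toℕ s)))
                                                  (cong toℕ (Inverse.strictlyInverseʳ x s))))

  sum-over-edges : (φ : ℕ → ℕ) → sum (φ ∘ pe) ≡ sum< M (λ j → isEdge (at j) * φ j)
  sum-over-edges φ = begin
    sum (φ ∘ pe)                                   ≡⟨ cong₂ _+_ (sym (sum-zero n))
                                                                (sum-cong-≗ (λ e → sym (+-identityʳ (φ (pe e))))) ⟩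
    sum {n} (λ _ → 0) + sum (λ e → 1 * φ (pe e))   ≡⟨ sum-by-position (λ a j → isEdge a * φ j) ⟩
    sum< M (λ j → isEdge (at j) * φ j)             ∎
    where open ≡-Reasoning

  sum-over-vertices : (φ : ℕ → ℕ) → sum (φ ∘ pv) ≡ sum< M (λ j → isVertex (at j) * φ j)
  sum-over-vertices φ = begin
    sum (φ ∘ pv)                                   ≡⟨ +-identityʳ _ ⟨
    sum (φ ∘ pv) + 0                               ≡⟨ cong₂ _+_ (sum-cong-≗ (λ v → sym (+-identityʳ (φ (pv v)))))
                                                                (sym (sum-zero n)) ⟩
    sum (λ v → 1 * φ (pv v)) + sum {n} (λ _ → 0)   ≡⟨ sum-by-position (λ a j → isVertex a * φ j) ⟩
    sum< M (λ j → isVertex (at j) * φ j)           ∎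
    where open ≡-Reasoning

  edgesBefore verticesBefore edgePositionSum : ℕ → ℕ
  edgesBefore     u = sum< u (λ j → isEdge (at j))
  verticesBefore  u = sum< u (λ j → isVertex (at j))
  edgePositionSum u = sum< u (λ j → isEdge (at j) * j)

  edgesBefore-count : ∀ {u} → u ≤ M → sum (λ e → ⟦ pe e < u ⟧) ≡ edgesBefore u
  edgesBefore-count {u} u≤M = trans (sum-over-edges (⟦_< u ⟧)) (sum<-⟦<⟧ (λ j → isEdge (at j)) u≤M)

  verticesBefore-count : ∀ {u} → u ≤ M → sum (λ v → ⟦ pv v < u ⟧) ≡ verticesBefore u
  verticesBefore-count {u} u≤M = trans (sum-over-vertices (⟦_< u ⟧)) (sum<-⟦<⟧ (λ j → isVertex (at j)) u≤M)

  edges+vertices-before : ∀ u → edgesBefore u + verticesBefore u ≡ u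
  edges+vertices-before u = begin
    edgesBefore u + verticesBefore u                   ≡⟨ sum<-+ u _ _ ⟨
    sum< u (λ j → isEdge (at j) + isVertex (at j))     ≡⟨ sum<-cong u (λ j _ → isEdge+isVertex (at j)) ⟩
    sum< u (λ _ → 1)                                   ≡⟨ sum<-1 u ⟩
    u                                                  ∎
    where open ≡-Reasoning

  edgesBefore-all : edgesBefore M ≡ n
  edgesBefore-all = trans (sym (edgesBefore-count ≤-refl))
    (≥1-everywhere⇒sum≡ (λ e → ⟦ pe e < M ⟧) (λ e → ⟦<⟧≤1 (pe e) M)
      (λ e → ≤-reflexive (sym (⟦<⟧≡1 (toℕ<n (Inverse.from x (inj₂ e)))))))

  sweep-vertex : ∀ {u v} → at u ≡ inj₁ v →
    edgesBefore (suc u) ≡ edgesBefore u × edgePositionSum (suc u) ≡ edgePositionSum u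
  sweep-vertex {u} at-u =
      trans (sum<-snoc u _) (trans (cong (λ a → edgesBefore u + isEdge a) at-u) (+-identityʳ _))
    , trans (sum<-snoc u _) (trans (cong (λ a → edgePositionSum u + isEdge a * u) at-u) (+-identityʳ _))

  sweep-edge : ∀ {u e} → at u ≡ inj₂ e →
    edgesBefore (suc u) ≡ suc (edgesBefore u) × edgePositionSum (suc u) ≡ edgePositionSum u + u
  sweep-edge {u} at-u =
      trans (sum<-snoc u _) (trans (cong (λ a → edgesBefore u + isEdge a) at-u) (+-comm _ 1))
    , trans (sum<-snoc u _)
        (trans (cong (λ a → edgePositionSum u + isEdge a * u) at-u) (cong (edgePositionSum u +_) (+-identityʳ u)))

  -- Count the edges in positions ≤ u against the vertices in positions < u.
  module EdgeAt {u e} (u<M : u < M) (at-u : at u ≡ inj₂ e) where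

    private
      F S : Fin n → ℕ
      F i = ⟦ pe i < suc u ⟧
      S v = ⟦ pv v < u ⟧

      F≤1 : ∀ i → F i ≤ 1
      F≤1 i = ⟦<⟧≤1 (pe i) (suc u)

      S≤1 : ∀ v → S v ≤ 1
      S≤1 v = ⟦<⟧≤1 (pv v) u

      ends∈S : ∀ i → 1 ≤ F i → 1 ≤ S i × 1 ≤ S (next i)
      ends∈S i Fi = ≤-reflexive (sym (⟦<⟧≡1 (<-≤-trans (proj₁ (x-cseq i)) i≤u)))
                  , ≤-reflexive (sym (⟦<⟧≡1 (<-≤-trans (proj₂ (x-cseq i)) i≤u)))
        where i≤u = s≤s⁻¹ (⟦<⟧-positive Fi)

      open CycleSubgraph F S F≤1 S≤1 ends∈S

      sum-F : sum F ≡ suc (edgesBefore u)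
      sum-F = trans (edgesBefore-count u<M) (proj₁ (sweep-edge at-u))

      sum-S : sum S ≡ verticesBefore u
      sum-S = verticesBefore-count (<⇒≤ u<M)

      pe-e : pe e ≡ u
      pe-e = trans (cong position (sym at-u)) (position-at u<M)

      F-e : 1 ≤ F e
      F-e = ≤-reflexive (sym (⟦<⟧≡1 (≤-reflexive (cong suc pe-e))))

    edgesBefore<n : edgesBefore u < n
    edgesBefore<n = subst (_≤ n) sum-F (sum-≤1 F F≤1)

    edge-after-vertices : suc (edgesBefore u) ≤ verticesBefore u
    edge-after-vertices = subst₂ _≤_ sum-F sum-S edges≤vertices

    edge-after-vertices⁺ : suc (edgesBefore u) < n → suc (edgesBefore u) < verticesBefore u
    edge-after-vertices⁺ 1+b<n with m≤n⇒m<n∨m≡n edge-after-vertices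
    ... | inj₁ 1+b<a = 1+b<a
    ... | inj₂ 1+b≡a =
      ⊥-elim (<⇒≢ 1+b<n (trans 1+b≡a (trans (sym sum-S) (edges≡vertices⇒spanning F-e F≡S))))
      where
      F≡S : sum F ≡ sum S
      F≡S = trans sum-F (trans 1+b≡a (sym sum-S))

    edge-position-bound : 2 * suc (edgesBefore u) ≤ 1 + u
    edge-position-bound = subst (λ w → 2 * suc (edgesBefore u) ≤ 1 + w) (edges+vertices-before u)
      (double-suc-≤ 1 (edgesBefore u) (verticesBefore u) (s≤s edge-after-vertices))

    edge-position-bound⁺ : suc (edgesBefore u) < n → 2 * suc (edgesBefore u) ≤ u
    edge-position-bound⁺ 1+b<n = subst (2 * suc (edgesBefore u) ≤_) (edges+vertices-before u)
      (double-suc-≤ 0 (edgesBefore u) (verticesBefore u) (edge-after-vertices⁺ 1+b<n))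

  Pronic : ℕ → ℕ → Set
  Pronic b s = (b < n → b * suc b ≤ s) × b * suc b ≤ suc s

  pronic-sweep : ∀ u → u ≤ M → Pronic (edgesBefore u) (edgePositionSum u)
  pronic-sweep zero    _   = (λ _ → z≤n) , z≤n
  pronic-sweep (suc u) u<M with at u in at-u
  ... | inj₁ v = subst₂ Pronic (sym (proj₁ step)) (sym (proj₂ step)) (pronic-sweep u (<⇒≤ u<M))
    where step = sweep-vertex at-u
  ... | inj₂ e = subst₂ Pronic (sym (proj₁ step)) (sym (proj₂ step))
                   ( (λ 1+b<n → pronic-step 0 _ _ u ih (edge-position-bound⁺ 1+b<n))
                   , pronic-step 1 _ _ u ih edge-position-bound)
    where
    open EdgeAt u<M at-u
    step = sweep-edge at-u
    ih = proj₁ (pronic-sweep u (<⇒≤ u<M)) edgesBefore<n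

  edge-positions-bound : n * suc n ≤ suc Pe
  edge-positions-bound = subst₂ (λ b s → b * suc b ≤ suc s) edgesBefore-all (sym (sum-over-edges (λ j → j)))
    (proj₂ (pronic-sweep M ≤-refl))

  cost-identity : cost (cycle n) x + Pv + Pv ≡ Pe + Pe
  cost-identity = begin
    cost (cycle n) x + Pv + Pv                ≡⟨ cong₂ (λ c t → c + Pv + t) (sum-tabulate c) (sym (sum-next pv)) ⟩
    sum c + sum pv + sum (pv ∘ next)          ≡⟨ cong (_+ sum (pv ∘ next)) (∑-distrib-+ c pv) ⟨
    sum (λ e → c e + pv e) + sum (pv ∘ next)  ≡⟨ ∑-distrib-+ (λ e → c e + pv e) (pv ∘ next) ⟨
    sum (λ e → c e + pv e + pv (next e))      ≡⟨ sum-cong-≗ (λ e → ∸-cost (proj₁ (x-cseq e)) (proj₂ (x-cseq e))) ⟩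
    sum (λ e → pe e + pe e)                   ≡⟨ ∑-distrib-+ pe pe ⟩
    Pe + Pe                                   ∎
    where
    open ≡-Reasoning
    c : Fin n → ℕ
    c = edgeCost (cycle n) x

  cost-≥ : 6 * n ∸ 4 ≤ cost (cycle n) x
  cost-≥ = cost-lower-bound-arithmetic n _ Pv Pe cost-identity
    (trans (cong (λ t → 2 * t + M) (sum-by-position (λ _ j → j))) (sum<-id M)) edge-positions-bound

coded↔ : ∀ {m} {A : Set} (code : A → ℕ) (decode : ℕ → A) → (∀ a → code a < m) →
  (∀ a → decode (code a) ≡ a) → (∀ t → t < m → code (decode t) ≡ t) → Fin m ↔ A
coded↔ code decode code<m decode-code code-decode = mk↔ₛ′ (decode ∘ toℕ) (λ a → fromℕ< (code<m a))
  (λ a → trans (cong decode (toℕ-fromℕ< (code<m a))) (decode-code a))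
  (λ t → toℕ-injective (trans (toℕ-fromℕ< _) (code-decode (toℕ t) (toℕ<n t))))

inject₁-or-fromℕ : ∀ {k} (P : Fin (suc k) → Set) → (∀ i → P (inject₁ i)) → P (fromℕ k) → ∀ e → P e
inject₁-or-fromℕ {zero}  P P-inject₁ P-fromℕ zero    = P-fromℕ
inject₁-or-fromℕ {suc k} P P-inject₁ P-fromℕ zero    = P-inject₁ zero
inject₁-or-fromℕ {suc k} P P-inject₁ P-fromℕ (suc e) = inject₁-or-fromℕ (P ∘ suc) (P-inject₁ ∘ suc) P-fromℕ e

-- staircase k t is the element in position 1 + t of  v₀ v₁ e₀ v₂ e₁ ⋯ vₖ eₖ₋₁ eₖ,
-- and offset k is its inverse away from v₀.
staircase : ∀ k → ℕ → Fin (suc k) ⊎ Fin (suc k)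
staircase zero    _             = inj₂ zero
staircase (suc k) zero          = inj₁ (suc zero)
staircase (suc k) (suc zero)    = inj₂ zero
staircase (suc k) (suc (suc t)) = Sum.map suc suc (staircase k t)

offset : ∀ k → Fin (suc k) ⊎ Fin (suc k) → ℕ
offset zero    _                    = 0
offset (suc k) (inj₁ zero)          = 0
offset (suc k) (inj₁ (suc zero))    = 0
offset (suc k) (inj₂ zero)          = 1
offset (suc k) (inj₁ (suc (suc i))) = 2 + offset k (inj₁ (suc i))
offset (suc k) (inj₂ (suc e))       = 2 + offset k (inj₂ e)

staircase≢v₀ : ∀ k t → staircase k t ≢ inj₁ zero
staircase≢v₀ zero    t             ()
staircase≢v₀ (suc k) zero          ()
staircase≢v₀ (suc k) (suc zero)    ()
staircase≢v₀ (suc k) (suc (suc t)) eq with staircase k t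
... | inj₁ _ with () ← eq
... | inj₂ _ with () ← eq

staircase-offset-vertex : ∀ k (i : Fin k) → staircase k (offset k (inj₁ (suc i))) ≡ inj₁ (suc i)
staircase-offset-vertex (suc k) zero    = refl
staircase-offset-vertex (suc k) (suc i) = cong (Sum.map suc suc) (staircase-offset-vertex k i)

staircase-offset-edge : ∀ k (e : Fin (suc k)) → staircase k (offset k (inj₂ e)) ≡ inj₂ e
staircase-offset-edge zero    zero    = refl
staircase-offset-edge (suc k) zero    = refl
staircase-offset-edge (suc k) (suc e) = cong (Sum.map suc suc) (staircase-offset-edge k e)

offset-shift : ∀ k a → a ≢ inj₁ zero → offset (suc k) (Sum.map suc suc a) ≡ 2 + offset k a
offset-shift k (inj₁ zero)    a≢v₀ = ⊥-elim (a≢v₀ refl)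
offset-shift k (inj₁ (suc i)) _    = refl
offset-shift k (inj₂ e)       _    = refl

offset-staircase : ∀ k t → t ≤ k + k → offset k (staircase k t) ≡ t
offset-staircase zero    zero          _ = refl
offset-staircase (suc k) zero          _ = refl
offset-staircase (suc k) (suc zero)    _ = refl
offset-staircase (suc k) (suc (suc t)) t≤ =
  trans (offset-shift k (staircase k t) (staircase≢v₀ k t))
        (cong (2 +_) (offset-staircase k t (s≤s⁻¹ (s≤s⁻¹ (subst (2 + t ≤_) (+-suc (suc k) k) t≤)))))

offset≤ : ∀ k a → offset k a ≤ k + k
offset≤ zero    _                    = z≤n
offset≤ (suc k) (inj₁ zero)          = z≤n
offset≤ (suc k) (inj₁ (suc zero))    = z≤n
offset≤ (suc k) (inj₂ zero)          = s≤s z≤n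
offset≤ (suc k) (inj₁ (suc (suc i))) = ≤-trans (s≤s (s≤s (offset≤ k _))) (≤-reflexive (sym (+-suc (suc k) k)))
offset≤ (suc k) (inj₂ (suc e))       = ≤-trans (s≤s (s≤s (offset≤ k _))) (≤-reflexive (sym (+-suc (suc k) k)))

offset-vertex : ∀ k (i : Fin k) → offset k (inj₁ (suc i)) ≡ 2 * toℕ i
offset-vertex (suc k) zero    = refl
offset-vertex (suc k) (suc i) = trans (cong (2 +_) (offset-vertex k i)) (sym (*-suc 2 (toℕ i)))

offset-inject₁ : ∀ k (i : Fin k) → offset k (inj₂ (inject₁ i)) ≡ suc (2 * toℕ i)
offset-inject₁ (suc k) zero    = refl
offset-inject₁ (suc k) (suc i) = trans (cong (2 +_) (offset-inject₁ k i)) (cong suc (sym (*-suc 2 (toℕ i))))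

offset-fromℕ : ∀ k → offset k (inj₂ (fromℕ k)) ≡ 2 * k
offset-fromℕ zero    = refl
offset-fromℕ (suc k) = trans (cong (2 +_) (offset-fromℕ k)) (sym (*-suc 2 k))

module Staircase (k : ℕ) where

  n : ℕ
  n = suc k

  code : Fin n ⊎ Fin n → ℕ
  code (inj₁ zero)    = 0
  code (inj₁ (suc i)) = suc (offset k (inj₁ (suc i)))
  code (inj₂ e)       = suc (offset k (inj₂ e))

  decode : ℕ → Fin n ⊎ Fin n
  decode zero    = inj₁ zero
  decode (suc t) = staircase k t

  code-≢v₀ : ∀ a → a ≢ inj₁ zero → code a ≡ suc (offset k a)
  code-≢v₀ (inj₁ zero)    a≢v₀ = ⊥-elim (a≢v₀ refl)
  code-≢v₀ (inj₁ (suc i)) _    = refl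
  code-≢v₀ (inj₂ e)       _    = refl

  suc-offset≤ : ∀ a → suc (offset k a) ≤ k + n
  suc-offset≤ a = ≤-trans (s≤s (offset≤ k a)) (≤-reflexive (sym (+-suc k k)))

  code< : ∀ a → code a < n + n
  code< (inj₁ zero)    = s≤s z≤n
  code< (inj₁ (suc i)) = s≤s (suc-offset≤ (inj₁ (suc i)))
  code< (inj₂ e)       = s≤s (suc-offset≤ (inj₂ e))

  decode-code : ∀ a → decode (code a) ≡ a
  decode-code (inj₁ zero)    = refl
  decode-code (inj₁ (suc i)) = staircase-offset-vertex k i
  decode-code (inj₂ e)       = staircase-offset-edge k e

  code-decode : ∀ t → t < n + n → code (decode t) ≡ t
  code-decode zero    _   = refl
  code-decode (suc t) t< = trans (code-≢v₀ (staircase k t) (staircase≢v₀ k t))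
    (cong suc (offset-staircase k t (s≤s⁻¹ (subst (suc t ≤_) (+-suc k k) (s≤s⁻¹ t<)))))

  sequence : Seq (cycle n)
  sequence = coded↔ code decode code< decode-code code-decode

  pos-sequence : ∀ a → pos {cycle n} sequence a ≡ code a
  pos-sequence a = toℕ-fromℕ< (code< a)

  code-vertex : ∀ v → code (inj₁ v) ≡ 2 * toℕ v ∸ 1
  code-vertex zero    = refl
  code-vertex (suc i) = trans (cong suc (offset-vertex k i)) (cong (_∸ 1) (sym (*-suc 2 (toℕ i))))

  code-inner-edge : ∀ i → code (inj₂ (inject₁ i)) ≡ 2 + 2 * toℕ i
  code-inner-edge i = cong suc (offset-inject₁ k i)

  code-last-edge : code (inj₂ (fromℕ k)) ≡ suc (2 * k)
  code-last-edge = cong suc (offset-fromℕ k)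

  code-cseq : ∀ e → code (inj₁ e) < code (inj₂ e) × code (inj₁ (next e)) < code (inj₂ e)
  code-cseq = inject₁-or-fromℕ _ inner last
    where
    inner : ∀ i → code (inj₁ (inject₁ i)) < code (inj₂ (inject₁ i))
                × code (inj₁ (next (inject₁ i))) < code (inj₂ (inject₁ i))
    inner i = subst₂ _<_ (sym (trans (code-vertex (inject₁ i)) (cong (λ y → 2 * y ∸ 1) (toℕ-inject₁ i))))
                         (sym (code-inner-edge i)) (s≤s (≤-trans (m∸n≤m _ 1) (n≤1+n _)))
            , subst₂ _<_ (sym (trans (cong (code ∘ inj₁) (next-inject₁ i)) (cong suc (offset-vertex k i))))
                         (sym (code-inner-edge i)) ≤-refl
    last : code (inj₁ (fromℕ k)) < code (inj₂ (fromℕ k))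
         × code (inj₁ (next (fromℕ k))) < code (inj₂ (fromℕ k))
    last = subst₂ _<_ (sym (trans (code-vertex (fromℕ k)) (cong (λ y → 2 * y ∸ 1) (toℕ-fromℕ k))))
                      (sym code-last-edge) (s≤s (m∸n≤m _ 1))
         , subst₂ _<_ (sym (cong (code ∘ inj₁) (next-fromℕ k))) (sym code-last-edge) (s≤s z≤n)

  sequence-cseq : IsCSeq (cycle n) sequence
  sequence-cseq e =
      subst₂ _<_ (sym (pos-sequence (inj₁ e))) (sym (pos-sequence (inj₂ e))) (proj₁ (code-cseq e))
    , subst₂ _<_ (sym (pos-sequence (inj₁ (next e)))) (sym (pos-sequence (inj₂ e))) (proj₂ (code-cseq e))

  edgeCost-sequence : ∀ e → edgeCost (cycle n) sequence e
                            ≡ (code (inj₂ e) ∸ code (inj₁ e)) + (code (inj₂ e) ∸ code (inj₁ (next e)))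
  edgeCost-sequence e = cong₂ _+_ (cong₂ _∸_ (pos-sequence (inj₂ e)) (pos-sequence (inj₁ e)))
                                  (cong₂ _∸_ (pos-sequence (inj₂ e)) (pos-sequence (inj₁ (next e))))

module _ (m : ℕ) where

  open Staircase (suc m)

  private
    c : Fin (2 + m) → ℕ
    c = edgeCost (cycle (2 + m)) sequence

  staircase-first-edge : c zero ≡ 3
  staircase-first-edge = trans (edgeCost-sequence zero) (cong (λ v → 2 + (2 ∸ code (inj₁ v))) (next-inject₁ zero))

  staircase-inner-edge : ∀ j → c (inject₁ (suc j)) ≡ 4
  staircase-inner-edge j = begin
    c (inject₁ (suc j))
      ≡⟨ edgeCost-sequence (inject₁ (suc j)) ⟩
    (code (inj₂ (suc (inject₁ j))) ∸ code (inj₁ (suc (inject₁ j))))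
      + (code (inj₂ (suc (inject₁ j))) ∸ code (inj₁ (next (inject₁ (suc j)))))
      ≡⟨ cong₂ _+_ (cong₂ _∸_ (code-inner-edge (suc j)) v-code)
                   (cong₂ _∸_ (code-inner-edge (suc j)) next-v-code) ⟩
    (2 + 2 * suc y ∸ (2 * suc y ∸ 1)) + (2 + 2 * suc y ∸ (2 * suc (suc y) ∸ 1))
      ≡⟨ cong₂ (λ a b → (2 + a ∸ (a ∸ 1)) + (2 + a ∸ (b ∸ 1))) (*-suc 2 y)
               (trans (*-suc 2 (suc y)) (cong (2 +_) (*-suc 2 y))) ⟩
    (3 + 2 * y ∸ 2 * y) + (1 + 2 * y ∸ 2 * y)
      ≡⟨ cong₂ _+_ (m+n∸n≡m 3 (2 * y)) (m+n∸n≡m 1 (2 * y)) ⟩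
    4 ∎
    where
    open ≡-Reasoning
    y = toℕ j
    v-code : code (inj₁ (suc (inject₁ j))) ≡ 2 * suc y ∸ 1
    v-code = trans (code-vertex (inject₁ (suc j))) (cong (λ t → 2 * t ∸ 1) (toℕ-inject₁ (suc j)))
    next-v-code : code (inj₁ (next (inject₁ (suc j)))) ≡ 2 * suc (suc y) ∸ 1
    next-v-code = trans (cong (code ∘ inj₁) (next-inject₁ (suc j))) (code-vertex (suc (suc j)))

  staircase-last-edge : c (fromℕ (suc m)) ≡ 2 + suc (2 * suc m)
  staircase-last-edge = begin
    c (fromℕ (suc m))
      ≡⟨ edgeCost-sequence (fromℕ (suc m)) ⟩
    (code (inj₂ (fromℕ (suc m))) ∸ code (inj₁ (fromℕ (suc m))))
      + (code (inj₂ (fromℕ (suc m))) ∸ code (inj₁ (next (fromℕ (suc m)))))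
      ≡⟨ cong₂ _+_ (cong₂ _∸_ code-last-edge v-code) (cong₂ _∸_ code-last-edge next-v-code) ⟩
    (suc (2 * suc m) ∸ (2 * suc m ∸ 1)) + suc (2 * suc m)
      ≡⟨ cong (_+ suc (2 * suc m)) (trans (cong (λ a → suc a ∸ (a ∸ 1)) (*-suc 2 m)) (m+n∸n≡m 2 (2 * m))) ⟩
    2 + suc (2 * suc m) ∎
    where
    open ≡-Reasoning
    v-code : code (inj₁ (fromℕ (suc m))) ≡ 2 * suc m ∸ 1
    v-code = trans (code-vertex (fromℕ (suc m))) (cong (λ t → 2 * t ∸ 1) (toℕ-fromℕ (suc m)))
    next-v-code : code (inj₁ (next (fromℕ (suc m)))) ≡ 0
    next-v-code = cong (code ∘ inj₁) (next-fromℕ (suc m))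

  staircase-cost : cost (cycle (2 + m)) sequence ≡ 6 * (2 + m) ∸ 4
  staircase-cost = begin
    cost (cycle (2 + m)) sequence                         ≡⟨ sum-tabulate c ⟩
    sum c                                                 ≡⟨ sum-init-last c ⟩
    c zero + sum (c ∘ inject₁ ∘ suc) + c (fromℕ (suc m))
      ≡⟨ cong₂ _+_ (cong₂ _+_ staircase-first-edge (sum-cong-≗ staircase-inner-edge)) staircase-last-edge ⟩
    3 + sum {m} (λ _ → 4) + (2 + suc (2 * suc m))
      ≡⟨ cong (λ s → 3 + s + (2 + suc (2 * suc m))) (sum-const m 4) ⟩
    3 + m * 4 + (2 + suc (2 * suc m))                     ≡⟨ solve (m ∷ []) ⟩
    8 + 6 * m                                             ≡⟨ m+n∸m≡n 4 (8 + 6 * m) ⟨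
    4 + (8 + 6 * m) ∸ 4                                   ≡⟨ cong (_∸ 4) 4+[8+6m]≡6[2+m] ⟩
    6 * (2 + m) ∸ 4                                       ∎
    where
    open ≡-Reasoning
    4+[8+6m]≡6[2+m] : 4 + (8 + 6 * m) ≡ 6 * (2 + m)
    4+[8+6m]≡6[2+m] = solve (m ∷ [])

theorem10 : ∀ (n : ℕ) → 3 ≤ n → IsSimple (cycle n) × IsMinCost (cycle n) (6 * n ∸ 4)
theorem10 (suc (suc (suc m))) (s≤s (s≤s (s≤s z≤n))) =
    cycle-simple m
  , (Staircase.sequence (2 + m) , Staircase.sequence-cseq (2 + m) , staircase-cost (suc m))
  , LowerBound.cost-≥
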